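{- $\mathrm{LPO}^*\leq_{\mathrm{W}}\left(-:\mathbf{COrd}\times\mathbf{COrd}\to\mathbf{COrd}\right)$, where $\alpha-\beta$ denotes the least ordinal $\gamma$ such that $\gamma+\beta\geq\alpha$.
   Context: A represented space is a pair $(X,\delta_X)$ with $\delta_X:\subseteq\mathbb{N}^\mathbb{N}\to X$ a partial surjection; $F$ realizes $f$ if $\delta_Y(F(p))\in f(\delta_X(p))$ for all names $p$ of points in $\mathrm{dom}(f)$. Weihrauch reducibility: $f\leq_{\mathrm{W}}g$ iff there are computable $K,H:\subseteq\mathbb{N}^\mathbb{N}\to\mathbb{N}^\mathbb{N}$ such that $p\mapsto K\langle p,G(H(p))\rangle$ realizes $f$ for every realizer $G$ of $g$. $\mathrm{LPO}:\mathbb{N}^\mathbb{N}\to\{0,1\}$ maps $0^\mathbb{N}$ to $1$ and all other $p$ to $0$; $\mathrm{LPO}^*$ is its finite parallelization: given $n\in\mathbb{N}$ and $p_1,\ldots,p_n$, output $(\mathrm{LPO}(p_1),\ldots,\mathrm{LPO}(p_n))$. $\mathbf{COrd}=(\mathrm{cord},\delta_{\mathrm{nK}})$ is the set of countable ordinals with $\delta_{\mathrm{nK}}(0p)=0$, $\delta_{\mathrm{nK}}(1p)=\delta_{\mathrm{nK}}(p)+1$, $\delta_{\mathrm{nK}}(2\langle p_0,p_1,\ldots\rangle)=\sup_{i}\delta_{\mathrm{nK}}(p_i)$, with $\langle\ldots\rangle$ a standard computable tupling on $\mathbb{N}^\mathbb{N}$. -}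

module Defs where

open import Data.Nat using (ℕ; zero; suc; _+_; _<_)
open import Data.Fin using (Fin)
open import Data.Vec using (Vec; []; _∷_; lookup)
open import Data.Product using (Σ; _×_)
open import Data.Sum using (_⊎_)
open import Data.Unit using (⊤)
open import Data.Empty using (⊥)
open import Relation.Binary.PropositionalEquality using (_≡_; _≢_)

Baire : Set
Baire = ℕ → ℕ

tail : Baire → Baire
tail p n = p (suc n)

-- ⟨p,q⟩(2n) = p(n), ⟨p,q⟩(2n+1) = q(n)
pair : Baire → Baire → Baire
pair p q zero = p zero
pair p q (suc zero) = q zero
pair p q (suc (suc n)) = pair (tail p) (tail q) n

-- Cantor pairing  π(i,j) = (i+j)(i+j+1)/2 + j
tri : ℕ → ℕ
tri zero = zero
tri (suc k) = tri k + suc k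

cantor : ℕ → ℕ → ℕ
cantor i j = tri (i + j) + j

-- i-th component of an infinite tuple ⟨p₀,p₁,…⟩, where ⟨p₀,p₁,…⟩(π(i,j)) = pᵢ(j)
component : ℕ → Baire → Baire
component i q j = q (cantor i j)

-- Type-2 computability via oracle (μ-)recursive functionals.
-- PR n : programs of arity n, with access to one function oracle.

data PR : ℕ → Set where
  Z : ∀ {n} → PR n
  S : PR 1
  P : ∀ {n} → Fin n → PR n
  O : PR 1
  C : ∀ {n m} → PR m → Vec (PR n) m → PR n
  R : ∀ {n} → PR n → PR (suc (suc n)) → PR (suc n)
  M : ∀ {n} → PR (suc n) → PR n

data Eval (p : Baire) : ∀ {n} → PR n → Vec ℕ n → ℕ → Set
data EvalV (p : Baire) : ∀ {n m} → Vec (PR n) m → Vec ℕ n → Vec ℕ m → Set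

data Eval p where
  eZ : ∀ {n} {xs : Vec ℕ n} → Eval p Z xs 0
  eS : ∀ {x} → Eval p S (x ∷ []) (suc x)
  eP : ∀ {n} {i : Fin n} {xs} → Eval p (P i) xs (lookup xs i)
  eO : ∀ {x} → Eval p O (x ∷ []) (p x)
  eC : ∀ {n m} {f : PR m} {gs : Vec (PR n) m} {xs ys v} →
       EvalV p gs xs ys → Eval p f ys v → Eval p (C f gs) xs v
  eR0 : ∀ {n} {f : PR n} {g xs v} → Eval p f xs v → Eval p (R f g) (0 ∷ xs) v
  eRS : ∀ {n} {f : PR n} {g xs k u v} →
        Eval p (R f g) (k ∷ xs) u → Eval p g (k ∷ u ∷ xs) v →
        Eval p (R f g) (suc k ∷ xs) v
  eM : ∀ {n} {f : PR (suc n)} {xs y} →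
       Eval p f (y ∷ xs) 0 →
       (∀ z → z < y → Σ ℕ λ k → Eval p f (z ∷ xs) (suc k)) →
       Eval p (M f) xs y

data EvalV p where
  [] : ∀ {n} {xs : Vec ℕ n} → EvalV p [] xs []
  _∷_ : ∀ {n m} {g : PR n} {gs : Vec (PR n) m} {xs y ys} →
        Eval p g xs y → EvalV p gs xs ys → EvalV p (g ∷ gs) xs (y ∷ ys)

Computes : PR 1 → Baire → Baire → Set
Computes e p q = ∀ n → Eval p e (n ∷ []) (q n)

record Problem : Set₁ where
  field
    Dom     : Baire → Set                 -- names of points in dom(f)
    Correct : (p : Baire) → Dom p → Baire → Set   -- q names a point in f(δ p)
open Problem public

Realizes : (Baire → Baire) → Problem → Set
Realizes G f = (p : Baire) (d : Dom f p) → Correct f p d (G p)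

_≤W_ : Problem → Problem → Set
f ≤W g = Σ (PR 1) λ eH → Σ (PR 1) λ eK →
  (G : Baire → Baire) → Realizes G g →
  (p : Baire) (d : Dom f p) →
  Σ Baire λ h → Computes eH p h ×
  Σ Baire λ k → Computes eK (pair p (G h)) k × Correct f p d k

-- LPO* : a name is n followed by ⟨p₀,p₁,…⟩ (only p₀..p_{n-1} used);
-- output in {0,1}ⁿ named by its first n digits.

LPOval : Baire → ℕ → Set
LPOval p b = (b ≡ 1 × (∀ j → p j ≡ 0)) ⊎ (b ≡ 0 × Σ ℕ λ j → p j ≢ 0)

LPO* : Problem
LPO* = record
  { Dom = λ _ → ⊤
  ; Correct = λ x _ k → ∀ i → i < x 0 → LPOval (component i (tail x)) (k i)
  }

-- Countable ordinals: Brouwer trees with their ordinal order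

data Ord : Set where
  oz : Ord
  os : Ord → Ord
  ol : (ℕ → Ord) → Ord

_≤o_ : Ord → Ord → Set
_<o_ : Ord → Ord → Set
oz ≤o β = ⊤
os α ≤o β = α <o β
ol f ≤o β = ∀ n → f n ≤o β
α <o oz = ⊥
α <o os β = α ≤o β
α <o ol g = Σ ℕ λ n → α <o g n

_+o_ : Ord → Ord → Ord
α +o oz = α
α +o os β = os (α +o β)
α +o ol g = ol (λ n → α +o g n)

data Name : Baire → Set where
  nz : ∀ {p} → p 0 ≡ 0 → Name p
  ns : ∀ {p} → p 0 ≡ 1 → Name (tail p) → Name p
  nl : ∀ {p} → p 0 ≡ 2 → (∀ i → Name (component i (tail p))) → Name p

δnK : ∀ {p} → Name p → Ord
δnK (nz _) = oz
δnK (ns _ n) = os (δnK n)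
δnK (nl _ f) = ol (λ i → δnK (f i))

IsDiff : Ord → Ord → Ord → Set
IsDiff α β γ = (α ≤o (γ +o β)) × (∀ δ → α ≤o (δ +o β) → γ ≤o δ)

-- names of COrd × COrd are ⟨p,q⟩
PairName : Baire → Set
PairName r = Name (λ n → r (n + n)) × Name (λ n → r (suc (n + n)))

Minus : Problem
Minus = record
  { Dom = PairName
  ; Correct = λ r d q → Σ (Name q) λ nq →
      IsDiff (δnK (Data.Product.proj₁ d)) (δnK (Data.Product.proj₂ d)) (δnK nq)
  }

-- An instance of LPO* is a number n and sequences p₀, …, pₙ₋₁. Let c(t) count the pᵢ having a
-- nonzero entry among their first t entries, and c∞ its eventual value. The forward map hands Minus
-- the finite ordinal n and the supremum over s of vₛ, the least j with c(⟨s,j⟩) ≤ j; since every vₛ is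
-- at most some c(t) and c(t) ≤ vₜ, the supremum is c∞ and the difference is γ = n − c∞. Given an
-- arbitrary name of γ, the backward map searches for a stage t together with a finite path through that
-- name witnessing γ ≥ m and n ≤ c(t) + m. Because γ ≤ n − c(T) for every T, such a t has c(t) = c∞:
-- every pᵢ that ever shows a nonzero entry has done so within its first t entries.

module Submission where

open import Defs
open import Data.Nat
open import Data.Nat.Properties
open import Data.Fin using (Fin; #_)
open import Data.Vec using (Vec; []; _∷_; lookup; map)
open import Data.Vec.Relation.Unary.All using (All; []; _∷_)
open import Data.Product using (Σ; ∃; _×_; _,_; proj₁; proj₂)
open import Data.Sum using (_⊎_; inj₁; inj₂; [_,_]′)
open import Data.Unit using (⊤; tt)
open import Data.Empty using (⊥-elim)
open import Data.List using (List; []; _∷_; _∷ʳ_; length; drop; reverse; foldl) renaming (map to mapL)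
open import Data.List.Properties using (drop-[]; drop-all; drop-drop; unfold-reverse; reverse-involutive; reverse-map; foldl-∷ʳ)
open import Data.List.Relation.Binary.Permutation.Propositional.Properties using (↭-reverse)
open import Data.Nat.ListAction using (sum)
open import Data.Nat.ListAction.Properties using (sum-↭)
open import Relation.Binary.PropositionalEquality
open import Relation.Binary.Definitions using (tri<; tri≈; tri>)
open import Relation.Nullary using (yes; no; contradiction)
open import Relation.Nullary.Decidable using (True)
open import Function using (_∘_; id)

infixl 30 _!_

_!_ : ∀ {n} → Vec ℕ n → (i : ℕ) {i<n : True (i <? n)} → ℕ
(xs ! i) {i<n} = lookup xs ((# i) {m<n = i<n})

Functional : ℕ → Set
Functional n = Baire → Vec ℕ n → ℕ

record Computable (n : ℕ) (F : Functional n) : Set where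
  constructor program
  field
    code : PR n
    runs : ∀ p xs → Eval p code xs (F p xs)
open Computable

Computable₁ : (Baire → ℕ → ℕ) → Set
Computable₁ f = Computable 1 (λ p xs → f p (xs ! 0))

codes : ∀ {n m} {Fs : Vec (Functional n) m} → All (Computable _) Fs → Vec (PR n) m
codes [] = []
codes (f ∷ fs) = code f ∷ codes fs

runsAll : ∀ {n m} {Fs : Vec (Functional n) m} (fs : All (Computable _) Fs) p xs →
          EvalV p (codes fs) xs (map (λ F → F p xs) Fs)
runsAll [] p xs = []
runsAll (f ∷ fs) p xs = runs f p xs ∷ runsAll fs p xs

infixl 6 _·_

_·_ : ∀ {n m} {F : Functional m} {Gs : Vec (Functional n) m} →
      Computable m F → All (Computable _) Gs → Computable n (λ p xs → F p (map (λ G → G p xs) Gs))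
f · gs = program (C (code f) (codes gs)) (λ p xs → eC (runsAll gs p xs) (runs f p _))

extensional : ∀ {n} {F G : Functional n} → Computable n F → (∀ p xs → F p xs ≡ G p xs) → Computable n G
extensional f F≗G = program (code f) (λ p xs → subst (Eval p (code f) xs) (F≗G p xs) (runs f p xs))

zeroᶜ : ∀ {n} → Computable n (λ _ _ → 0)
zeroᶜ = program Z (λ _ _ → eZ)

sucᶜ : Computable 1 (λ _ xs → suc (xs ! 0))
sucᶜ = program S (λ { _ (_ ∷ []) → eS })

proj : ∀ {n} (i : Fin n) → Computable n (λ _ xs → lookup xs i)
proj i = program (P i) (λ _ _ → eP)

oracle : Computable₁ (λ p → p)
oracle = program O (λ { _ (_ ∷ []) → eO })

recursionᶜ : ∀ {n} {F : Functional n} {G : Functional (suc (suc n))} {H : Functional (suc n)} →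
             Computable n F → Computable (suc (suc n)) G →
             (∀ p xs → H p (0 ∷ xs) ≡ F p xs) →
             (∀ p k xs → H p (suc k ∷ xs) ≡ G p (k ∷ H p (k ∷ xs) ∷ xs)) →
             Computable (suc n) H
recursionᶜ {H = H} f g base step = program (R (code f) (code g)) run
  where
  run : ∀ p xs → Eval p (R (code f) (code g)) xs (H p xs)
  run p (zero ∷ xs) = subst (Eval p _ _) (sym (base p xs)) (eR0 (runs f p xs))
  run p (suc k ∷ xs) = subst (Eval p _ _) (sym (step p k xs)) (eRS (run p (k ∷ xs)) (runs g p (k ∷ H p (k ∷ xs) ∷ xs)))

IsLeastZero : (ℕ → ℕ) → ℕ → Set
IsLeastZero f y = f y ≡ 0 × (∀ z → z < y → f z ≢ 0)

eval-μ : ∀ {n} {F : Functional (suc n)} (f : Computable (suc n) F) p xs y →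
         IsLeastZero (λ z → F p (z ∷ xs)) y → Eval p (M (code f)) xs y
eval-μ {F = F} f p xs y (Fy≡0 , below) = eM (subst (Eval p (code f) _) Fy≡0 (runs f p _)) above
  where
  above : ∀ z → z < y → ∃ λ k → Eval p (code f) (z ∷ xs) (suc k)
  above z z<y with F p (z ∷ xs) in Fz≡ | below z z<y
  ... | zero | Fz≢0 = ⊥-elim (Fz≢0 refl)
  ... | suc k | _ = k , subst (Eval p (code f) _) Fz≡ (runs f p _)

searchZero : ∀ f y → ∃ (IsLeastZero f) ⊎ (∀ z → z ≤ y → f z ≢ 0)
searchZero f zero with f 0 ≟ 0
... | yes f0≡0 = inj₁ (0 , f0≡0 , λ _ ())
... | no f0≢0 = inj₂ (λ { zero z≤n → f0≢0 })
searchZero f (suc y) with searchZero f y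
... | inj₁ least = inj₁ least
... | inj₂ below with f (suc y) ≟ 0
...   | yes fy≡0 = inj₁ (suc y , fy≡0 , λ z z<1+y → below z (≤-pred z<1+y))
...   | no fy≢0 = inj₂ (λ z z≤1+y → [ (λ z<1+y → below z (≤-pred z<1+y)) , (λ { refl → fy≢0 }) ]′ (m≤n⇒m<n∨m≡n z≤1+y))

-- Opaque, so that the type checker never tries to run the search on open terms.
opaque
  leastZero : ∀ f y → f y ≡ 0 → ∃ (IsLeastZero f)
  leastZero f y fy≡0 = [ id , (λ none → ⊥-elim (none y ≤-refl fy≡0)) ]′ (searchZero f y)

x₀ : ∀ {n} → Computable (suc n) (λ _ xs → xs ! 0)
x₀ = proj (# 0)

x₁ : ∀ {n} → Computable (suc (suc n)) (λ _ xs → xs ! 1)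
x₁ = proj (# 1)

x₂ : ∀ {n} → Computable (suc (suc (suc n))) (λ _ xs → xs ! 2)
x₂ = proj (# 2)

x₃ : ∀ {n} → Computable (suc (suc (suc (suc n)))) (λ _ xs → xs ! 3)
x₃ = proj (# 3)

constᶜ : ∀ {n} k → Computable n (λ _ _ → k)
constᶜ zero = zeroᶜ
constᶜ (suc k) = sucᶜ · (constᶜ k ∷ [])

sg : ℕ → ℕ
sg zero = 0
sg (suc _) = 1

isZero : ℕ → ℕ
isZero zero = 1
isZero (suc _) = 0

ifZero_then_else_ : ℕ → ℕ → ℕ → ℕ
ifZero zero then a else b = a
ifZero suc _ then a else b = b

sg≤1 : ∀ a → sg a ≤ 1
sg≤1 zero = z≤n
sg≤1 (suc a) = ≤-refl

sg-mono-≤ : ∀ {a b} → a ≤ b → sg a ≤ sg b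
sg-mono-≤ {zero} _ = z≤n
sg-mono-≤ {suc a} (s≤s _) = ≤-refl

sg≡0⇒≡0 : ∀ {a} → sg a ≡ 0 → a ≡ 0
sg≡0⇒≡0 {zero} _ = refl

sg-positive : ∀ {a} → 0 < a → 0 < sg a
sg-positive {suc a} _ = s≤s z≤n

sg≡0⊎sg≡1 : ∀ a → sg a ≡ 0 ⊎ sg a ≡ 1
sg≡0⊎sg≡1 zero = inj₁ refl
sg≡0⊎sg≡1 (suc a) = inj₂ refl

sg[m∸n]≡1⇒n<m : ∀ m n → sg (m ∸ n) ≡ 1 → n < m
sg[m∸n]≡1⇒n<m m n sg≡1 = ≰⇒> (λ m≤n → 0≢1+n (trans (cong sg (sym (m≤n⇒m∸n≡0 m≤n))) sg≡1))

sg[m∸n]≡0⇒m≤n : ∀ m n → sg (m ∸ n) ≡ 0 → m ≤ n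
sg[m∸n]≡0⇒m≤n m n sg≡0 = m∸n≡0⇒m≤n (sg≡0⇒≡0 sg≡0)

predᶜ : Computable 1 (λ _ xs → pred (xs ! 0))
predᶜ = recursionᶜ zeroᶜ x₀ (λ _ _ → refl) (λ _ _ _ → refl)

+ᶜ : Computable 2 (λ _ xs → xs ! 0 + xs ! 1)
+ᶜ = recursionᶜ x₀ (sucᶜ · (x₁ ∷ [])) (λ _ _ → refl) (λ _ _ _ → refl)

∸ᶜ : Computable 2 (λ _ xs → xs ! 0 ∸ xs ! 1)
∸ᶜ = flipped · (x₁ ∷ x₀ ∷ [])
  where
  flipped : Computable 2 (λ _ xs → xs ! 1 ∸ xs ! 0)
  flipped = recursionᶜ x₀ (predᶜ · (x₁ ∷ [])) (λ _ _ → refl) (λ { _ k (m ∷ []) → sym (pred[m∸n]≡m∸[1+n] m k) })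

sgᶜ : Computable 1 (λ _ xs → sg (xs ! 0))
sgᶜ = recursionᶜ zeroᶜ (constᶜ 1) (λ _ _ → refl) (λ _ _ _ → refl)

isZeroᶜ : Computable 1 (λ _ xs → isZero (xs ! 0))
isZeroᶜ = recursionᶜ (constᶜ 1) zeroᶜ (λ _ _ → refl) (λ _ _ _ → refl)

ifZeroᶜ : Computable 3 (λ _ xs → ifZero xs ! 0 then xs ! 1 else xs ! 2)
ifZeroᶜ = recursionᶜ x₀ x₃ (λ _ _ → refl) (λ _ _ _ → refl)

∣m-n∣≡m∸n+n∸m : ∀ m n → ∣ m - n ∣ ≡ (m ∸ n) + (n ∸ m)
∣m-n∣≡m∸n+n∸m zero n = cong (_+ n) (sym (0∸n≡0 n))
∣m-n∣≡m∸n+n∸m (suc m) zero = sym (+-identityʳ (suc m))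
∣m-n∣≡m∸n+n∸m (suc m) (suc n) = ∣m-n∣≡m∸n+n∸m m n

∣-∣ᶜ : Computable 2 (λ _ xs → ∣ xs ! 0 - xs ! 1 ∣)
∣-∣ᶜ = extensional (+ᶜ · (∸ᶜ ∷ ∸ᶜ · (x₁ ∷ x₀ ∷ []) ∷ []))
  λ { _ (m ∷ n ∷ []) → sym (∣m-n∣≡m∸n+n∸m m n) }

-- Cantor pairing

triᶜ : Computable 1 (λ _ xs → tri (xs ! 0))
triᶜ = recursionᶜ zeroᶜ (+ᶜ · (x₁ ∷ sucᶜ · (x₀ ∷ []) ∷ [])) (λ _ _ → refl) (λ _ _ _ → refl)

cantorᶜ : Computable 2 (λ _ xs → cantor (xs ! 0) (xs ! 1))
cantorᶜ = +ᶜ · (triᶜ · (+ᶜ · (x₀ ∷ x₁ ∷ []) ∷ []) ∷ x₁ ∷ [])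

n≤tri : ∀ n → n ≤ tri n
n≤tri zero = z≤n
n≤tri (suc n) = m≤n+m (suc n) (tri n)

tri-mono-≤ : ∀ {m n} → m ≤ n → tri m ≤ tri n
tri-mono-≤ z≤n = z≤n
tri-mono-≤ (s≤s m≤n) = +-mono-≤ (tri-mono-≤ m≤n) (s≤s m≤n)

diagonal : ℕ → ℕ
diagonal zero = 0
diagonal (suc w) = diagonal w + isZero (tri (suc (diagonal w)) ∸ suc w)

diagonalᶜ : Computable 1 (λ _ xs → diagonal (xs ! 0))
diagonalᶜ = recursionᶜ zeroᶜ (+ᶜ · (x₁ ∷ isZeroᶜ · (∸ᶜ · (triᶜ · (sucᶜ · (x₁ ∷ []) ∷ []) ∷ sucᶜ · (x₀ ∷ []) ∷ []) ∷ []) ∷ []))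
  (λ _ _ → refl) (λ _ _ _ → refl)

TriBracket : ℕ → ℕ → Set
TriBracket d w = tri d ≤ w × w < tri (suc d)

TriBracket-unique : ∀ {d e w} → TriBracket d w → TriBracket e w → d ≡ e
TriBracket-unique {d} {e} (d≤w , w<d) (e≤w , w<e) with <-cmp d e
... | tri≈ _ d≡e _ = d≡e
... | tri< d<e _ _ = ⊥-elim (<-irrefl refl (<-≤-trans w<d (≤-trans (tri-mono-≤ d<e) e≤w)))
... | tri> _ _ e<d = ⊥-elim (<-irrefl refl (<-≤-trans w<e (≤-trans (tri-mono-≤ e<d) d≤w)))

diagonal-bracket : ∀ w → TriBracket (diagonal w) w
diagonal-bracket zero = z≤n , s≤s z≤n
diagonal-bracket (suc w) = step (diagonal w) (diagonal-bracket w)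
  where
  step : ∀ d → TriBracket d w → TriBracket (d + isZero (tri (suc d) ∸ suc w)) (suc w)
  step d (lo , hi) with tri (suc d) ∸ suc w in eq
  ... | zero rewrite +-comm d 1 | ≤-antisym (m∸n≡0⇒m≤n eq) hi = ≤-refl , m<m+n (suc w) (s≤s z≤n)
  ... | suc _ rewrite +-identityʳ d = m≤n⇒m≤1+n lo , ≰⇒> (λ reached → 0≢1+n (trans (sym (m≤n⇒m∸n≡0 reached)) eq))

cantor-bracket : ∀ i j → TriBracket (i + j) (cantor i j)
cantor-bracket i j = m≤m+n (tri (i + j)) j , +-monoʳ-< (tri (i + j)) (s≤s (m≤n+m j i))

diagonal-cantor : ∀ i j → diagonal (cantor i j) ≡ i + j
diagonal-cantor i j = TriBracket-unique (diagonal-bracket (cantor i j)) (cantor-bracket i j)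

cantor₂ : ℕ → ℕ
cantor₂ w = w ∸ tri (diagonal w)

cantor₁ : ℕ → ℕ
cantor₁ w = diagonal w ∸ cantor₂ w

cantor₂ᶜ : Computable 1 (λ _ xs → cantor₂ (xs ! 0))
cantor₂ᶜ = ∸ᶜ · (x₀ ∷ triᶜ · (diagonalᶜ ∷ []) ∷ [])

cantor₁ᶜ : Computable 1 (λ _ xs → cantor₁ (xs ! 0))
cantor₁ᶜ = ∸ᶜ · (diagonalᶜ ∷ cantor₂ᶜ ∷ [])

cantor₂-cantor : ∀ i j → cantor₂ (cantor i j) ≡ j
cantor₂-cantor i j = trans (cong (λ d → cantor i j ∸ tri d) (diagonal-cantor i j)) (m+n∸m≡n (tri (i + j)) j)

cantor₁-cantor : ∀ i j → cantor₁ (cantor i j) ≡ i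
cantor₁-cantor i j = trans (cong₂ _∸_ (diagonal-cantor i j) (cantor₂-cantor i j)) (m+n∸n≡m i j)

cantor₂≤diagonal : ∀ w → cantor₂ w ≤ diagonal w
cantor₂≤diagonal w = ≤-pred (subst (cantor₂ w <_) (m+n∸m≡n (tri d) (suc d)) (∸-monoˡ-< hi lo))
  where
  d = diagonal w
  lo = proj₁ (diagonal-bracket w)
  hi = proj₂ (diagonal-bracket w)

cantor-cantor₁-cantor₂ : ∀ w → cantor (cantor₁ w) (cantor₂ w) ≡ w
cantor-cantor₁-cantor₂ w = begin
  tri (cantor₁ w + cantor₂ w) + cantor₂ w  ≡⟨ cong (λ d → tri d + cantor₂ w) (m∸n+n≡m (cantor₂≤diagonal w)) ⟩
  tri (diagonal w) + cantor₂ w             ≡⟨ m+[n∸m]≡n (proj₁ (diagonal-bracket w)) ⟩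
  w                                        ∎
  where open ≡-Reasoning

cantor₂≤ : ∀ w → cantor₂ w ≤ w
cantor₂≤ w = m∸n≤m w (tri (diagonal w))

j≤cantor : ∀ i j → j ≤ cantor i j
j≤cantor i j = m≤n+m j _

i≤cantor : ∀ i j → i ≤ cantor i j
i≤cantor i j = ≤-trans (m≤m+n i j) (≤-trans (n≤tri (i + j)) (m≤m+n _ j))

pair-even : ∀ p q a → pair p q (a + a) ≡ p a
pair-even p q zero = refl
pair-even p q (suc a) rewrite +-suc a a = pair-even (tail p) (tail q) a

pair-odd : ∀ p q a → pair p q (suc (a + a)) ≡ q a
pair-odd p q zero = refl
pair-odd p q (suc a) rewrite +-suc a a = pair-odd (tail p) (tail q) a

isOdd : ℕ → ℕ
isOdd zero = 0
isOdd (suc m) = isZero (isOdd m)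

half : ℕ → ℕ
half zero = 0
half (suc m) = half m + isOdd m

isOddᶜ : Computable 1 (λ _ xs → isOdd (xs ! 0))
isOddᶜ = recursionᶜ zeroᶜ (isZeroᶜ · (x₁ ∷ [])) (λ _ _ → refl) (λ _ _ _ → refl)

halfᶜ : Computable 1 (λ _ xs → half (xs ! 0))
halfᶜ = recursionᶜ zeroᶜ (+ᶜ · (x₁ ∷ isOddᶜ · (x₀ ∷ []) ∷ [])) (λ _ _ → refl) (λ _ _ _ → refl)

isOdd-double : ∀ a → isOdd (a + a) ≡ 0
isOdd-double zero = refl
isOdd-double (suc a) rewrite +-suc a a | isOdd-double a = refl

half-double : ∀ a → half (a + a) ≡ a
half-double zero = refl
half-double (suc a) rewrite +-suc a a | isOdd-double a | half-double a | +-identityʳ a = +-comm a 1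

interleave : (ℕ → ℕ) → (ℕ → ℕ) → ℕ → ℕ
interleave f g m = ifZero isOdd m then f (half m) else g (half m)

interleave-even : ∀ f g a → interleave f g (a + a) ≡ f a
interleave-even f g a rewrite isOdd-double a | half-double a = refl

interleave-odd : ∀ f g a → interleave f g (suc (a + a)) ≡ g a
interleave-odd f g a rewrite isOdd-double a | half-double a | +-identityʳ a = refl

sumBelow : ℕ → (ℕ → ℕ) → ℕ
sumBelow zero f = 0
sumBelow (suc N) f = sumBelow N f + f N

sumBelowᶜ : ∀ {F : Functional 2} → Computable 2 F →
            Computable 2 (λ p xs → sumBelow (xs ! 0) (λ u → F p (u ∷ xs ! 1 ∷ [])))
sumBelowᶜ f = recursionᶜ zeroᶜ (+ᶜ · (x₁ ∷ f · (x₀ ∷ x₂ ∷ []) ∷ [])) (λ _ _ → refl) (λ _ _ _ → refl)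

module _ {f g : ℕ → ℕ} where

  sumBelow-cong : ∀ N → (∀ u → u < N → f u ≡ g u) → sumBelow N f ≡ sumBelow N g
  sumBelow-cong zero _ = refl
  sumBelow-cong (suc N) f≡g = cong₂ _+_ (sumBelow-cong N (λ u u<N → f≡g u (m<n⇒m<1+n u<N))) (f≡g N ≤-refl)

  sumBelow-mono-≤ : ∀ N → (∀ u → u < N → f u ≤ g u) → sumBelow N f ≤ sumBelow N g
  sumBelow-mono-≤ zero _ = z≤n
  sumBelow-mono-≤ (suc N) f≤g = +-mono-≤ (sumBelow-mono-≤ N (λ u u<N → f≤g u (m<n⇒m<1+n u<N))) (f≤g N ≤-refl)

  sumBelow-mono-< : ∀ N → (∀ u → u < N → f u ≤ g u) → ∀ i → i < N → f i < g i → sumBelow N f < sumBelow N g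
  sumBelow-mono-< (suc N) f≤g i i<1+N fi<gi with m≤n⇒m<n∨m≡n (≤-pred i<1+N)
  ... | inj₁ i<N = +-mono-<-≤ (sumBelow-mono-< N (λ u u<N → f≤g u (m<n⇒m<1+n u<N)) i i<N fi<gi) (f≤g N ≤-refl)
  ... | inj₂ refl = +-mono-≤-< (sumBelow-mono-≤ N (λ u u<N → f≤g u (m<n⇒m<1+n u<N))) fi<gi

module _ {f : ℕ → ℕ} where

  sumBelow-monoˡ-≤ : ∀ {m n} → m ≤ n → sumBelow m f ≤ sumBelow n f
  sumBelow-monoˡ-≤ {m} {zero} z≤n = ≤-refl
  sumBelow-monoˡ-≤ {m} {suc n} m≤1+n with m≤n⇒m<n∨m≡n m≤1+n
  ... | inj₁ m<1+n = ≤-trans (sumBelow-monoˡ-≤ (≤-pred m<1+n)) (m≤m+n (sumBelow n f) (f n))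
  ... | inj₂ refl = ≤-refl

  term≤sumBelow : ∀ {u N} → u < N → f u ≤ sumBelow N f
  term≤sumBelow {u} {N} u<N = ≤-trans (m≤n+m (f u) (sumBelow u f)) (sumBelow-monoˡ-≤ u<N)

  sumBelow≡0⇒ : ∀ N → sumBelow N f ≡ 0 → ∀ u → u < N → f u ≡ 0
  sumBelow≡0⇒ N sum≡0 u u<N = n≤0⇒n≡0 (subst (f u ≤_) sum≡0 (term≤sumBelow u<N))

  sumBelow≡0⇐ : ∀ N → (∀ u → u < N → f u ≡ 0) → sumBelow N f ≡ 0
  sumBelow≡0⇐ zero _ = refl
  sumBelow≡0⇐ (suc N) f≡0 = cong₂ _+_ (sumBelow≡0⇐ N (λ u u<N → f≡0 u (m<n⇒m<1+n u<N))) (f≡0 N ≤-refl)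

  sumBelow≢0⇒ : ∀ N → sumBelow N f ≢ 0 → ∃ λ u → f u ≢ 0
  sumBelow≢0⇒ zero sum≢0 = ⊥-elim (sum≢0 refl)
  sumBelow≢0⇒ (suc N) sum≢0 with f N ≟ 0
  ... | no fN≢0 = N , fN≢0
  ... | yes fN≡0 = sumBelow≢0⇒ N (λ sum≡0 → sum≢0 (cong₂ _+_ sum≡0 fN≡0))

  sumBelow-bounded : (∀ u → f u ≤ 1) → ∀ N → sumBelow N f ≤ N
  sumBelow-bounded f≤1 zero = z≤n
  sumBelow-bounded f≤1 (suc N) = subst (sumBelow N f + f N ≤_) (+-comm N 1) (+-mono-≤ (sumBelow-bounded f≤1 N) (f≤1 N))

sumBelow-suc : ∀ N f → sumBelow (suc N) f ≡ f 0 + sumBelow N (f ∘ suc)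
sumBelow-suc zero f = +-comm 0 (f 0)
sumBelow-suc (suc N) f = trans (cong (_+ f (suc N)) (sumBelow-suc N f)) (+-assoc (f 0) _ _)

-- Detecting nonzero entries

hits : Baire → ℕ → ℕ → ℕ
hits x t i = sumBelow t (component i (tail x))

detected : Baire → ℕ → ℕ
detected x t = sumBelow (x 0) (λ i → sg (hits x t i))

hitsᶜ : ∀ {X} → Computable₁ X → Computable 2 (λ p xs → hits (X p) (xs ! 0) (xs ! 1))
hitsᶜ read = sumBelowᶜ (read · (sucᶜ · (cantorᶜ · (x₁ ∷ x₀ ∷ []) ∷ []) ∷ []))

detectedᶜ : ∀ {X} → Computable₁ X → Computable₁ (λ p → detected (X p))
detectedᶜ {X} read = sumBelowᶜ (sgᶜ · (hitsᶜ {X} read · (x₁ ∷ x₀ ∷ []) ∷ [])) · (read · (zeroᶜ ∷ []) ∷ x₀ ∷ [])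

hits-cong : ∀ {x y} → (∀ w → x w ≡ y w) → ∀ t i → hits x t i ≡ hits y t i
hits-cong x≗y t i = sumBelow-cong t (λ j _ → x≗y (suc (cantor i j)))

detected-cong : ∀ {x y} → (∀ w → x w ≡ y w) → ∀ t → detected x t ≡ detected y t
detected-cong {x} {y} x≗y t = trans (cong (λ n → sumBelow n (λ i → sg (hits x t i))) (x≗y 0))
  (sumBelow-cong (y 0) (λ i _ → cong sg (hits-cong x≗y t i)))

detected≤ : ∀ x t → detected x t ≤ x 0
detected≤ x t = sumBelow-bounded (λ i → sg≤1 (hits x t i)) (x 0)

detected-mono-≤ : ∀ x {t t′} → t ≤ t′ → detected x t ≤ detected x t′
detected-mono-≤ x t≤t′ = sumBelow-mono-≤ (x 0) (λ i _ → sg-mono-≤ (sumBelow-monoˡ-≤ t≤t′))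

detected-grows : ∀ x t {i j} → i < x 0 → hits x t i ≡ 0 → component i (tail x) j ≢ 0 →
                 detected x t < detected x (t + suc j)
detected-grows x t {i} {j} i<n unseen hit =
  sumBelow-mono-< (x 0) (λ k _ → sg-mono-≤ (sumBelow-monoˡ-≤ t≤t′)) i i<n (subst (λ a → sg a < sg (hits x t′ i)) (sym unseen) seen)
  where
  t′ : ℕ
  t′ = t + suc j
  t≤t′ : t ≤ t′
  t≤t′ = m≤m+n t (suc j)
  seen : 0 < sg (hits x t′ i)
  seen = sg-positive (≤-trans (n≢0⇒n>0 hit) (term≤sumBelow (m≤n+m (suc j) t)))

stable-stage-decides : ∀ x t → (∀ T → detected x T ≤ detected x t) →
                       ∀ i → i < x 0 → LPOval (component i (tail x)) (isZero (hits x t i))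
stable-stage-decides x t stable i i<n with hits x t i in hits≡
... | zero = inj₁ (refl , all-zero)
  where
  all-zero : ∀ j → component i (tail x) j ≡ 0
  all-zero j with component i (tail x) j ≟ 0
  ... | yes xj≡0 = xj≡0
  ... | no xj≢0 = ⊥-elim (<⇒≱ (detected-grows x t i<n hits≡ xj≢0) (stable (t + suc j)))
... | suc _ = inj₂ (refl , sumBelow≢0⇒ t (λ hits≡0 → 0≢1+n (trans (sym hits≡0) hits≡)))

-- Finite ordinals and paths through names

finite : ℕ → Ord
finite zero = oz
finite (suc n) = os (finite n)

finite-mono-≤o : ∀ {m n} → m ≤ n → finite m ≤o finite n
finite-mono-≤o z≤n = tt
finite-mono-≤o (s≤s m≤n) = finite-mono-≤o m≤n

finite-+o : ∀ m n → finite m +o finite n ≡ finite (n + m)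
finite-+o m zero = refl
finite-+o m (suc n) = cong os (finite-+o m n)

≤o-finite⇒≤ : ∀ {m n} γ → finite m ≤o γ → γ ≤o finite n → m ≤ n
<o-finite⇒< : ∀ {m n} γ → finite m <o γ → γ ≤o finite n → m < n
≤o-finite⇒≤ {zero} γ _ _ = z≤n
≤o-finite⇒≤ {suc m} γ m<γ γ≤n = <o-finite⇒< γ m<γ γ≤n
<o-finite⇒< {n = suc n} (os γ) m≤γ γ<n = s≤s (≤o-finite⇒≤ γ m≤γ γ<n)
<o-finite⇒< (ol f) (i , m<fi) f≤n = <o-finite⇒< (f i) m<fi (f≤n i)

finite-antitone-≤o : ∀ {m n} γ → n ≤ m → finite m ≤o γ → finite n ≤o γ
finite-antitone-<o : ∀ {m n} γ → n ≤ m → finite m <o γ → finite n <o γ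
finite-antitone-≤o γ z≤n _ = tt
finite-antitone-≤o γ (s≤s n≤m) m<γ = finite-antitone-<o γ n≤m m<γ
finite-antitone-<o (os γ) n≤m m≤γ = finite-antitone-≤o γ n≤m m≤γ
finite-antitone-<o (ol f) n≤m (i , m<fi) = i , finite-antitone-<o (f i) n≤m m<fi

≤o-ol : ∀ α (f : ℕ → Ord) i → α ≤o f i → α ≤o ol f
≤o-ol oz f i _ = tt
≤o-ol (os α) f i α<fi = i , α<fi
≤o-ol (ol g) f i g≤fi = λ n → ≤o-ol (g n) f i (g≤fi n)

finite≤o+ol : ∀ m γ (f : ℕ → Ord) → finite m ≤o (γ +o ol f) → ∃ λ i → finite m ≤o (γ +o f i)
finite≤o+ol zero γ f _ = 0 , tt
finite≤o+ol (suc m) γ f m<γ+f = m<γ+f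

finite-∸ : ∀ m n γ → finite m ≤o (γ +o finite n) → finite (m ∸ n) ≤o γ
finite-∸ m zero γ m≤γ = m≤γ
finite-∸ zero (suc n) γ _ = tt
finite-∸ (suc m) (suc n) γ m<γ+n = finite-∸ m n γ m<γ+n

-- A path through a name q is a list of steps: 0 passes from a successor name to the name of its
-- predecessor, suc i from a limit name to its i-th component. Digit j of the name reached by step e
-- sits at position descend e j, and the head digit expected before step e is tag e.
descend : ℕ → ℕ → ℕ
descend e j = suc (ifZero e then j else cantor (pred e) j)

tag : ℕ → ℕ
tag e = ifZero e then 1 else 2

IsPath : Baire → List ℕ → Set
IsPath q [] = ⊤
IsPath q (e ∷ es) = q 0 ≡ tag e × IsPath (λ j → q (descend e j)) es

successors : List ℕ → ℕ
successors es = sum (mapL isZero es)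

path-sound : ∀ {q} es → IsPath q es → (nm : Name q) → finite (successors es) ≤o δnK nm
path-sound [] _ _ = tt
path-sound (zero ∷ es) (_ , path) (ns _ nm) = path-sound es path nm
path-sound (suc i ∷ es) (_ , path) (nl _ nms) = ≤o-ol (finite (successors es)) (λ k → δnK (nms k)) i (path-sound es path (nms i))
path-sound (zero ∷ _) (q0≡1 , _) (nz q0≡0) = contradiction (trans (sym q0≡0) q0≡1) λ ()
path-sound (zero ∷ _) (q0≡1 , _) (nl q0≡2 _) = contradiction (trans (sym q0≡2) q0≡1) λ ()
path-sound (suc _ ∷ _) (q0≡2 , _) (nz q0≡0) = contradiction (trans (sym q0≡0) q0≡2) λ ()
path-sound (suc _ ∷ _) (q0≡2 , _) (ns q0≡1 _) = contradiction (trans (sym q0≡1) q0≡2) λ ()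

path-complete : ∀ {q} m (nm : Name q) → finite m ≤o δnK nm → ∃ λ es → IsPath q es × m ≤ successors es
path-complete zero nm _ = [] , tt , z≤n
path-complete (suc m) (ns q0≡1 nm) m≤α with path-complete m nm m≤α
... | es , path , m≤es = zero ∷ es , (q0≡1 , path) , s≤s m≤es
path-complete (suc m) (nl q0≡2 nms) (i , m<αi) with path-complete (suc m) (nms i) m<αi
... | es , path , m≤es = suc i ∷ es , (q0≡2 , path) , m≤es

record FiniteName (q : Baire) : Set where
  field
    size : ℕ
    name : Name q
    denotes : δnK name ≡ finite size
    ones : ∀ j → j < size → q j ≡ 1
    first-zero : q size ≡ 0
open FiniteName

finiteName : ∀ N q → (∀ j → q j ≡ 0 ⊎ q j ≡ 1) → q N ≡ 0 → FiniteName q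
finiteName N q bit qN≡0 with bit 0
... | inj₁ q0≡0 = record { size = 0 ; name = nz q0≡0 ; denotes = refl ; ones = λ _ () ; first-zero = q0≡0 }
finiteName zero q bit qN≡0 | inj₂ q0≡1 = ⊥-elim (0≢1+n (trans (sym qN≡0) q0≡1))
finiteName (suc N) q bit qN≡0 | inj₂ q0≡1 = record
  { size = suc (size rest)
  ; name = ns q0≡1 (name rest)
  ; denotes = cong os (denotes rest)
  ; ones = λ { zero _ → q0≡1 ; (suc j) (s≤s j<n) → ones rest j j<n }
  ; first-zero = first-zero rest
  }
  where
  rest : FiniteName (tail q)
  rest = finiteName N (tail q) (λ j → bit (suc j)) qN≡0

module CountdownName {q : Baire} {f : ℕ → ℕ} (q≗ : ∀ j → q j ≡ sg (f j ∸ j)) where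

  countdownName : ∀ N → (∀ j → f j ≤ N) → FiniteName q
  countdownName N f≤N = finiteName N q (λ j → subst (λ b → b ≡ 0 ⊎ b ≡ 1) (sym (q≗ j)) (sg≡0⊎sg≡1 _))
    (trans (q≗ N) (cong sg (m≤n⇒m∸n≡0 (f≤N N))))

  below-size : (fn : FiniteName q) → ∀ j → j < size fn → j < f j
  below-size fn j j<size = sg[m∸n]≡1⇒n<m (f j) j (trans (sym (q≗ j)) (ones fn j j<size))

  at-size : (fn : FiniteName q) → f (size fn) ≤ size fn
  at-size fn = sg[m∸n]≡0⇒m≤n (f (size fn)) (size fn) (trans (sym (q≗ (size fn))) (first-zero fn))

-- Paths coded by numbers

encode : List ℕ → ℕ
encode [] = 0
encode (e ∷ es) = suc (cantor e (encode es))

codeHead : ℕ → ℕ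
codeHead z = cantor₁ (pred z)

codeTail : ℕ → ℕ
codeTail z = cantor₂ (pred z)

codeDrop : ℕ → ℕ → ℕ
codeDrop zero z = z
codeDrop (suc u) z = codeTail (codeDrop u z)

length≤encode : ∀ es → length es ≤ encode es
length≤encode [] = z≤n
length≤encode (e ∷ es) = s≤s (≤-trans (length≤encode es) (j≤cantor e (encode es)))

codeHead-encode : ∀ e es → codeHead (encode (e ∷ es)) ≡ e
codeHead-encode e es = cantor₁-cantor e (encode es)

codeTail-encode : ∀ es → codeTail (encode es) ≡ encode (drop 1 es)
codeTail-encode [] = refl
codeTail-encode (e ∷ es) = cantor₂-cantor e (encode es)

codeDrop-encode : ∀ u es → codeDrop u (encode es) ≡ encode (drop u es)
codeDrop-encode zero es = refl
codeDrop-encode (suc u) es = begin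
  codeTail (codeDrop u (encode es))  ≡⟨ cong codeTail (codeDrop-encode u es) ⟩
  codeTail (encode (drop u es))      ≡⟨ codeTail-encode (drop u es) ⟩
  encode (drop 1 (drop u es))        ≡⟨ cong encode (drop-drop u 1 es) ⟩
  encode (drop (u + 1) es)           ≡⟨ cong (λ k → encode (drop k es)) (+-comm u 1) ⟩
  encode (drop (suc u) es)           ∎
  where open ≡-Reasoning

codeDrop-suc : ∀ u z → codeDrop (suc u) z ≡ codeDrop u (codeTail z)
codeDrop-suc zero z = refl
codeDrop-suc (suc u) z = cong codeTail (codeDrop-suc u z)

codeDrop-zero : ∀ u → codeDrop u 0 ≡ 0
codeDrop-zero zero = refl
codeDrop-zero (suc u) = cong codeTail (codeDrop-zero u)

descendAll : ℕ → List ℕ → ℕ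
descendAll = foldl (λ j e → descend e j)

codeFold : ℕ → ℕ → ℕ → ℕ
codeFold zero z j = j
codeFold (suc u) z j = ifZero codeDrop u z then codeFold u z j else descend (codeHead (codeDrop u z)) (codeFold u z j)

codeFold-suc : ∀ u w j → codeFold (suc u) (suc w) j ≡ codeFold u (codeTail (suc w)) (descend (codeHead (suc w)) j)
codeFold-suc zero w j = refl
codeFold-suc (suc u) w j rewrite codeFold-suc u w j | codeDrop-suc u (suc w) = refl

codeFold-zero : ∀ u j → codeFold u 0 j ≡ j
codeFold-zero zero j = refl
codeFold-zero (suc u) j rewrite codeDrop-zero u = codeFold-zero u j

codeFold-encode : ∀ es u j → length es ≤ u → codeFold u (encode es) j ≡ descendAll j es
codeFold-encode [] u j _ = codeFold-zero u j
codeFold-encode (e ∷ es) (suc u) j (s≤s es≤u) = begin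
  codeFold (suc u) (encode (e ∷ es)) j                                ≡⟨ codeFold-suc u (cantor e (encode es)) j ⟩
  codeFold u (codeTail (encode (e ∷ es))) (descend (codeHead (encode (e ∷ es))) j)
    ≡⟨ cong₂ (λ z k → codeFold u z (descend k j)) (codeTail-encode (e ∷ es)) (codeHead-encode e es) ⟩
  codeFold u (encode es) (descend e j)                                ≡⟨ codeFold-encode es u (descend e j) es≤u ⟩
  descendAll (descend e j) es                                         ∎
  where open ≡-Reasoning

codeAddress : ℕ → ℕ
codeAddress z = codeFold z z 0

codeAddress-encode : ∀ es → codeAddress (encode es) ≡ descendAll 0 es
codeAddress-encode es = codeFold-encode es (encode es) 0 (length≤encode es)

-- Codes store a path innermost step first: then the positions to be checked are those of the suffixes of
-- the code, which primitive recursion reaches by iterating codeTail.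
IsReversedPath : Baire → List ℕ → Set
IsReversedPath q [] = ⊤
IsReversedPath q (r ∷ rs) = q (descendAll 0 rs) ≡ tag r × IsReversedPath q rs

reversedPath-∷ʳ⁺ : ∀ q e rs → q 0 ≡ tag e → IsReversedPath (λ j → q (descend e j)) rs → IsReversedPath q (rs ∷ʳ e)
reversedPath-∷ʳ⁺ q e [] matches _ = matches , tt
reversedPath-∷ʳ⁺ q e (r ∷ rs) matches (matches′ , path) =
  subst (λ a → q a ≡ tag r) (sym (foldl-∷ʳ (λ j e → descend e j) 0 e rs)) matches′ , reversedPath-∷ʳ⁺ q e rs matches path

reversedPath-∷ʳ⁻ : ∀ q e rs → IsReversedPath q (rs ∷ʳ e) → q 0 ≡ tag e × IsReversedPath (λ j → q (descend e j)) rs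
reversedPath-∷ʳ⁻ q e [] (matches , _) = matches , tt
reversedPath-∷ʳ⁻ q e (r ∷ rs) (matches′ , path) with reversedPath-∷ʳ⁻ q e rs path
... | matches , path′ = matches , subst (λ a → q a ≡ tag r) (foldl-∷ʳ (λ j e → descend e j) 0 e rs) matches′ , path′

path⇒reversedPath : ∀ q es → IsPath q es → IsReversedPath q (reverse es)
path⇒reversedPath q [] _ = tt
path⇒reversedPath q (e ∷ es) (matches , path) rewrite unfold-reverse e es =
  reversedPath-∷ʳ⁺ q e (reverse es) matches (path⇒reversedPath (λ j → q (descend e j)) es path)

reversedPath⇒path : ∀ q es → IsReversedPath q (reverse es) → IsPath q es
reversedPath⇒path q [] _ = tt
reversedPath⇒path q (e ∷ es) path rewrite unfold-reverse e es with reversedPath-∷ʳ⁻ q e (reverse es) path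
... | matches , path′ = matches , reversedPath⇒path (λ j → q (descend e j)) es path′

mismatchAt : Baire → List ℕ → ℕ
mismatchAt q [] = 0
mismatchAt q (r ∷ rs) = ∣ q (descendAll 0 rs) - tag r ∣

reversedPath⇒mismatch≡0 : ∀ q rs → IsReversedPath q rs → ∀ u → mismatchAt q (drop u rs) ≡ 0
reversedPath⇒mismatch≡0 q [] _ u rewrite drop-[] {A = ℕ} u = refl
reversedPath⇒mismatch≡0 q (r ∷ rs) (matches , _) zero = m≡n⇒∣m-n∣≡0 matches
reversedPath⇒mismatch≡0 q (r ∷ rs) (_ , path) (suc u) = reversedPath⇒mismatch≡0 q rs path u

mismatch≡0⇒reversedPath : ∀ q rs → (∀ u → mismatchAt q (drop u rs) ≡ 0) → IsReversedPath q rs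
mismatch≡0⇒reversedPath q [] _ = tt
mismatch≡0⇒reversedPath q (r ∷ rs) none = ∣m-n∣≡0⇒m≡n (none 0) , mismatch≡0⇒reversedPath q rs (none ∘ suc)

suffixMismatch : Baire → ℕ → ℕ
suffixMismatch q z = ifZero z then 0 else ∣ q (codeAddress (codeTail z)) - tag (codeHead z) ∣

mismatches : Baire → ℕ → ℕ
mismatches q z = sumBelow z (λ u → suffixMismatch q (codeDrop u z))

suffixMismatch-encode : ∀ q rs → suffixMismatch q (encode rs) ≡ mismatchAt q rs
suffixMismatch-encode q [] = refl
suffixMismatch-encode q (r ∷ rs) =
  cong₂ (λ a b → ∣ q a - tag b ∣) (trans (cong codeAddress (codeTail-encode (r ∷ rs))) (codeAddress-encode rs)) (codeHead-encode r rs)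

suffixMismatch-codeDrop : ∀ q rs u → suffixMismatch q (codeDrop u (encode rs)) ≡ mismatchAt q (drop u rs)
suffixMismatch-codeDrop q rs u = trans (cong (suffixMismatch q) (codeDrop-encode u rs)) (suffixMismatch-encode q (drop u rs))

mismatches≡0⇒reversedPath : ∀ q rs → mismatches q (encode rs) ≡ 0 → IsReversedPath q rs
mismatches≡0⇒reversedPath q rs none = mismatch≡0⇒reversedPath q rs none′
  where
  none′ : ∀ u → mismatchAt q (drop u rs) ≡ 0
  none′ u with u <? encode rs
  ... | yes u<z = trans (sym (suffixMismatch-codeDrop q rs u)) (sumBelow≡0⇒ (encode rs) none u u<z)
  ... | no u≮z rewrite drop-all u rs (≤-trans (length≤encode rs) (≮⇒≥ u≮z)) = refl

reversedPath⇒mismatches≡0 : ∀ q rs → IsReversedPath q rs → mismatches q (encode rs) ≡ 0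
reversedPath⇒mismatches≡0 q rs path =
  sumBelow≡0⇐ (encode rs) (λ u _ → trans (suffixMismatch-codeDrop q rs u) (reversedPath⇒mismatch≡0 q rs path u))

headIsZero : ℕ → ℕ
headIsZero z = ifZero z then 0 else isZero (codeHead z)

successorCount : ℕ → ℕ
successorCount z = sumBelow z (λ u → headIsZero (codeDrop u z))

successorCount-encode : ∀ rs → successorCount (encode rs) ≡ successors rs
successorCount-encode rs = trans (sumBelow-cong (encode rs) (λ u _ → cong headIsZero (codeDrop-encode u rs)))
  (sumBelow-drops rs (encode rs) (length≤encode rs))
  where
  sumBelow-drops : ∀ rs N → length rs ≤ N → sumBelow N (λ u → headIsZero (encode (drop u rs))) ≡ successors rs
  sumBelow-drops [] N _ = sumBelow≡0⇐ N (λ u _ → cong (headIsZero ∘ encode) (drop-[] u))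
  sumBelow-drops (r ∷ rs) (suc N) (s≤s rs≤N) = begin
    sumBelow (suc N) (λ u → headIsZero (encode (drop u (r ∷ rs))))       ≡⟨ sumBelow-suc N _ ⟩
    headIsZero (encode (r ∷ rs)) + sumBelow N (λ u → headIsZero (encode (drop u rs)))
      ≡⟨ cong₂ _+_ (cong isZero (codeHead-encode r rs)) (sumBelow-drops rs N rs≤N) ⟩
    isZero r + successors rs                                             ∎
    where open ≡-Reasoning

successors-reverse : ∀ es → successors (reverse es) ≡ successors es
successors-reverse es = trans (cong sum (reverse-map isZero es)) (sum-↭ (↭-reverse (mapL isZero es)))

encode-surjective : ∀ z → ∃ λ rs → encode rs ≡ z
encode-surjective z = decode z z ≤-refl
  where
  decode : ∀ fuel z → z ≤ fuel → ∃ λ rs → encode rs ≡ z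
  decode _ zero _ = [] , refl
  decode (suc fuel) (suc w) (s≤s w≤fuel) with decode fuel (cantor₂ w) (≤-trans (cantor₂≤ w) w≤fuel)
  ... | rs , rs≡ = cantor₁ w ∷ rs , cong suc (trans (cong (cantor (cantor₁ w)) rs≡) (cantor-cantor₁-cantor₂ w))

mismatches-cong : ∀ {q q′} → (∀ w → q w ≡ q′ w) → ∀ z → mismatches q z ≡ mismatches q′ z
mismatches-cong {q} {q′} q≗q′ z = sumBelow-cong z (λ u _ → suffixMismatch-cong (codeDrop u z))
  where
  suffixMismatch-cong : ∀ z → suffixMismatch q z ≡ suffixMismatch q′ z
  suffixMismatch-cong z = cong (λ a → ifZero z then 0 else ∣ a - tag (codeHead z) ∣) (q≗q′ (codeAddress (codeTail z)))

pathCode : List ℕ → ℕ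
pathCode es = encode (reverse es)

path⇒mismatches≡0 : ∀ q es → IsPath q es → mismatches q (pathCode es) ≡ 0
path⇒mismatches≡0 q es path = reversedPath⇒mismatches≡0 q (reverse es) (path⇒reversedPath q es path)

successorCount-pathCode : ∀ es → successorCount (pathCode es) ≡ successors es
successorCount-pathCode es = trans (successorCount-encode (reverse es)) (successors-reverse es)

mismatches≡0⇒path : ∀ q z → mismatches q z ≡ 0 → ∃ λ es → IsPath q es × successorCount z ≡ successors es
mismatches≡0⇒path q z none with encode-surjective z
... | rs , refl = reverse rs , reversedPath⇒path q (reverse rs) reversed
                , trans (successorCount-encode rs) (sym (successors-reverse rs))
  where
  reversed : IsReversedPath q (reverse (reverse rs))
  reversed = subst (IsReversedPath q) (sym (reverse-involutive rs)) (mismatches≡0⇒reversedPath q rs none)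

descendᶜ : Computable 2 (λ _ xs → descend (xs ! 0) (xs ! 1))
descendᶜ = sucᶜ · (ifZeroᶜ · (x₀ ∷ x₁ ∷ cantorᶜ · (predᶜ · (x₀ ∷ []) ∷ x₁ ∷ []) ∷ []) ∷ [])

tagᶜ : Computable 1 (λ _ xs → tag (xs ! 0))
tagᶜ = ifZeroᶜ · (x₀ ∷ constᶜ 1 ∷ constᶜ 2 ∷ [])

codeHeadᶜ : Computable 1 (λ _ xs → codeHead (xs ! 0))
codeHeadᶜ = cantor₁ᶜ · (predᶜ ∷ [])

codeTailᶜ : Computable 1 (λ _ xs → codeTail (xs ! 0))
codeTailᶜ = cantor₂ᶜ · (predᶜ ∷ [])

codeDropᶜ : Computable 2 (λ _ xs → codeDrop (xs ! 0) (xs ! 1))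
codeDropᶜ = recursionᶜ x₀ (codeTailᶜ · (x₁ ∷ [])) (λ _ _ → refl) (λ _ _ _ → refl)

codeFoldᶜ : Computable 3 (λ _ xs → codeFold (xs ! 0) (xs ! 1) (xs ! 2))
codeFoldᶜ = recursionᶜ x₁ (ifZeroᶜ · (rest ∷ x₁ ∷ descendᶜ · (codeHeadᶜ · (rest ∷ []) ∷ x₁ ∷ []) ∷ []))
  (λ _ _ → refl) (λ _ _ _ → refl)
  where
  rest : Computable 4 (λ _ xs → codeDrop (xs ! 0) (xs ! 2))
  rest = codeDropᶜ · (x₀ ∷ x₂ ∷ [])

codeAddressᶜ : Computable 1 (λ _ xs → codeAddress (xs ! 0))
codeAddressᶜ = codeFoldᶜ · (x₀ ∷ x₀ ∷ zeroᶜ ∷ [])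

suffixMismatchᶜ : ∀ {Q} → Computable₁ Q → Computable₁ (λ p → suffixMismatch (Q p))
suffixMismatchᶜ read = ifZeroᶜ · (x₀ ∷ zeroᶜ ∷ ∣-∣ᶜ · (read · (codeAddressᶜ · (codeTailᶜ ∷ []) ∷ []) ∷ tagᶜ · (codeHeadᶜ ∷ []) ∷ []) ∷ [])

mismatchesᶜ : ∀ {Q} → Computable₁ Q → Computable₁ (λ p → mismatches (Q p))
mismatchesᶜ {Q} read = sumBelowᶜ (suffixMismatchᶜ {Q} read · (codeDropᶜ · (x₀ ∷ x₁ ∷ []) ∷ [])) · (x₀ ∷ x₀ ∷ [])

headIsZeroᶜ : Computable₁ (λ _ → headIsZero)
headIsZeroᶜ = ifZeroᶜ · (x₀ ∷ zeroᶜ ∷ isZeroᶜ · (codeHeadᶜ ∷ []) ∷ [])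

successorCountᶜ : Computable₁ (λ _ → successorCount)
successorCountᶜ = sumBelowᶜ (headIsZeroᶜ · (codeDropᶜ · (x₀ ∷ x₁ ∷ []) ∷ [])) · (x₀ ∷ x₀ ∷ [])

-- The reduction

minuendDigit : Baire → ℕ → ℕ
minuendDigit x j = sg (x 0 ∸ j)

subtrahendDigit : Baire → ℕ → ℕ
subtrahendDigit x w = ifZero w then 2 else sg (detected x (pred w) ∸ cantor₂ (pred w))

preprocess : Baire → Baire
preprocess x = interleave (minuendDigit x) (subtrahendDigit x)

preprocessᶜ : Computable₁ preprocess
preprocessᶜ = ifZeroᶜ · (isOddᶜ ∷ minuendᶜ · (halfᶜ ∷ []) ∷ subtrahendᶜ · (halfᶜ ∷ []) ∷ [])
  where
  minuendᶜ : Computable₁ minuendDigit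
  minuendᶜ = sgᶜ · (∸ᶜ · (oracle · (zeroᶜ ∷ []) ∷ x₀ ∷ []) ∷ [])
  subtrahendᶜ : Computable₁ subtrahendDigit
  subtrahendᶜ = ifZeroᶜ · (x₀ ∷ constᶜ 2 ∷ sgᶜ · (∸ᶜ · (detectedᶜ {λ p → p} oracle · (predᶜ ∷ []) ∷ cantor₂ᶜ · (predᶜ ∷ []) ∷ []) ∷ []) ∷ [])

evens : Baire → Baire
evens r w = r (w + w)

odds : Baire → Baire
odds r w = r (suc (w + w))

evensᶜ : Computable₁ evens
evensᶜ = oracle · (+ᶜ · (x₀ ∷ x₀ ∷ []) ∷ [])

oddsᶜ : Computable₁ odds
oddsᶜ = oracle · (sucᶜ · (+ᶜ · (x₀ ∷ x₀ ∷ []) ∷ []) ∷ [])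

rejection : Baire → Baire → ℕ → ℕ
rejection x q y = mismatches q (cantor₂ y) + (x 0 ∸ (detected x (cantor₁ y) + successorCount (cantor₂ y)))

rejection-pair : ∀ x q y → rejection (evens (pair x q)) (odds (pair x q)) y ≡ rejection x q y
rejection-pair x q y = cong₂ (λ a c → a + (x 0 ∸ (c + successorCount (cantor₂ y))))
  (mismatches-cong (pair-odd x q) (cantor₂ y)) (detected-cong (pair-even x q) (cantor₁ y))

rejection-accepts : ∀ x q t es → IsPath q es → x 0 ≤ detected x t + successors es →
                    rejection x q (cantor t (pathCode es)) ≡ 0
rejection-accepts x q t es path n≤ rewrite cantor₁-cantor t (pathCode es) | cantor₂-cantor t (pathCode es)
  | successorCount-pathCode es = cong₂ _+_ (path⇒mismatches≡0 q es path) (m≤n⇒m∸n≡0 n≤)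

rejection≡0⇒path : ∀ x q y → rejection x q y ≡ 0 → ∃ λ es → IsPath q es × x 0 ≤ detected x (cantor₁ y) + successors es
rejection≡0⇒path x q y rejection≡0 with mismatches≡0⇒path q (cantor₂ y) (m+n≡0⇒m≡0 _ rejection≡0)
... | es , path , count≡ = es , path , subst (λ m → x 0 ≤ detected x (cantor₁ y) + m) count≡
  (m∸n≡0⇒m≤n (m+n≡0⇒n≡0 (mismatches q (cantor₂ y)) rejection≡0))

rejectionᶜ : Computable 2 (λ r xs → rejection (evens r) (odds r) (xs ! 0))
rejectionᶜ = +ᶜ · (mismatchesᶜ {odds} oddsᶜ · (cantor₂ᶜ · (x₀ ∷ []) ∷ []) ∷ ∸ᶜ · (evensᶜ · (zeroᶜ ∷ []) ∷ +ᶜ ·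
  (detectedᶜ {evens} evensᶜ · (cantor₁ᶜ · (x₀ ∷ []) ∷ []) ∷ successorCountᶜ · (cantor₂ᶜ · (x₀ ∷ []) ∷ []) ∷ []) ∷ []) ∷ [])

answerᶜ : Computable 2 (λ r xs → isZero (hits (evens r) (cantor₁ (xs ! 1)) (xs ! 0)))
answerᶜ = isZeroᶜ · (hitsᶜ {evens} evensᶜ · (cantor₁ᶜ · (x₁ ∷ []) ∷ x₀ ∷ []) ∷ [])

postprocess : PR 1
postprocess = C (code answerᶜ) (P (# 0) ∷ M (code rejectionᶜ) ∷ [])

module Correctness (G : Baire → Baire) (G-realizes : Realizes G Minus) (x : Baire) where

  n : ℕ
  n = x 0

  h : Baire
  h = preprocess x

  d : ℕ → ℕ
  d = detected x

  minuend : FiniteName (λ j → h (j + j))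
  minuend = CountdownName.countdownName (interleave-even (minuendDigit x) (subtrahendDigit x)) n (λ _ → ≤-refl)

  minuend-size : size minuend ≡ n
  minuend-size = ≤-antisym (≮⇒≥ (λ n<size → <-irrefl refl (below-size minuend n n<size))) (at-size minuend)
    where open CountdownName (interleave-even (minuendDigit x) (subtrahendDigit x))

  minuend-denotes : δnK (name minuend) ≡ finite n
  minuend-denotes = trans (denotes minuend) (cong finite minuend-size)

  stage-digit : ∀ s j → component s (tail (λ j → h (suc (j + j)))) j ≡ sg (d (cantor s j) ∸ j)
  stage-digit s j = trans (interleave-odd (minuendDigit x) (subtrahendDigit x) (suc (cantor s j)))
    (cong (λ k → sg (d (cantor s j) ∸ k)) (cantor₂-cantor s j))

  stage : ∀ s → FiniteName (component s (tail (λ j → h (suc (j + j)))))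
  stage s = CountdownName.countdownName (stage-digit s) n (λ j → detected≤ x (cantor s j))

  v : ℕ → ℕ
  v s = size (stage s)

  subtrahend : Name (λ j → h (suc (j + j)))
  subtrahend = nl refl (λ s → name (stage s))

  v≤detected : ∀ s → ∃ λ t → v s ≤ d t
  v≤detected s with v s in v≡
  ... | zero = 0 , z≤n
  ... | suc k = cantor s k , below-size (stage s) k (subst (k <_) (sym v≡) ≤-refl)
    where open CountdownName (stage-digit s)

  detected≤v : ∀ t → d t ≤ v t
  detected≤v t = ≤-trans (detected-mono-≤ x (i≤cantor t (v t))) (at-size (stage t))
    where open CountdownName (stage-digit t)

  difference : Σ (Name (G h)) λ nγ → IsDiff (δnK (name minuend)) (δnK subtrahend) (δnK nγ)
  difference = G-realizes h (name minuend , subtrahend)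

  γ : Ord
  γ = δnK (proj₁ difference)

  γ-reaches : ∃ λ t → finite (n ∸ d t) ≤o γ
  γ-reaches = reach (finite≤o+ol n γ (λ s → δnK (name (stage s))) n≤γ+β)
    where
    n≤γ+β : finite n ≤o (γ +o δnK subtrahend)
    n≤γ+β = subst (_≤o (γ +o δnK subtrahend)) minuend-denotes (proj₁ (proj₂ difference))
    reach : (∃ λ s → finite n ≤o (γ +o δnK (name (stage s)))) → ∃ λ t → finite (n ∸ d t) ≤o γ
    reach (s , n≤γ+vs) = proj₁ (v≤detected s) , finite-antitone-≤o γ (∸-monoʳ-≤ n (proj₂ (v≤detected s))) n∸vs≤γ
      where
      n∸vs≤γ : finite (n ∸ v s) ≤o γ
      n∸vs≤γ = finite-∸ n (v s) γ (subst (λ β → finite n ≤o (γ +o β)) (denotes (stage s)) n≤γ+vs)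

  γ-bounded : ∀ t → γ ≤o finite (n ∸ d t)
  γ-bounded t = proj₂ (proj₂ difference) (finite (n ∸ d t)) n≤[n∸dt]+β
    where
    n≤[n∸dt]+vt : finite n ≤o (finite (n ∸ d t) +o δnK (name (stage t)))
    n≤[n∸dt]+vt rewrite denotes (stage t) | finite-+o (n ∸ d t) (v t) =
      finite-mono-≤o (≤-trans (m≤n+m∸n n (d t)) (+-monoˡ-≤ (n ∸ d t) (detected≤v t)))
    n≤[n∸dt]+β : δnK (name minuend) ≤o (finite (n ∸ d t) +o δnK subtrahend)
    n≤[n∸dt]+β rewrite minuend-denotes = ≤o-ol (finite n) _ t n≤[n∸dt]+vt

  accepted : ∃ λ y → rejection x (G h) y ≡ 0
  accepted = witness (proj₁ γ-reaches) (path-complete _ (proj₁ difference) (proj₂ γ-reaches))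
    where
    witness : ∀ t → (∃ λ es → IsPath (G h) es × n ∸ d t ≤ successors es) → ∃ λ y → rejection x (G h) y ≡ 0
    witness t (es , path , n∸dt≤es) = cantor t (pathCode es) ,
      rejection-accepts x (G h) t es path (≤-trans (m≤n+m∸n n (d t)) (+-monoʳ-≤ (d t) n∸dt≤es))

  -- The path bounds γ from below by its number m of successor steps, while γ ≤ n − d T for every T;
  -- so n ≤ d t + m leaves no room for d T to exceed d t.
  accepted-stable : ∀ y → rejection x (G h) y ≡ 0 → ∀ T → d T ≤ d (cantor₁ y)
  accepted-stable y rejection≡0 T = stable (rejection≡0⇒path x (G h) y rejection≡0)
    where
    stable : (∃ λ es → IsPath (G h) es × n ≤ d (cantor₁ y) + successors es) → d T ≤ d (cantor₁ y)
    stable (es , path , n≤) = +-cancelʳ-≤ (n ∸ d T) (d T) (d (cantor₁ y)) (begin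
        d T + (n ∸ d T)               ≡⟨ m+[n∸m]≡n (detected≤ x T) ⟩
        n                             ≤⟨ n≤ ⟩
        d (cantor₁ y) + successors es ≤⟨ +-monoʳ-≤ (d (cantor₁ y)) (≤o-finite⇒≤ γ (path-sound es path (proj₁ difference)) (γ-bounded T)) ⟩
        d (cantor₁ y) + (n ∸ d T)     ∎)
      where open ≤-Reasoning

  r : Baire
  r = pair x (G h)

  search : ∃ (IsLeastZero (λ y → rejection (evens r) (odds r) y))
  search = leastZero (λ y → rejection (evens r) (odds r) y) (proj₁ accepted) (trans (rejection-pair x (G h) (proj₁ accepted)) (proj₂ accepted))

  stable-stage : ℕ
  stable-stage = cantor₁ (proj₁ search)

  answer : Baire
  answer i = isZero (hits (evens r) stable-stage i)

  answer-computed : Computes postprocess r answer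
  answer-computed i = eC (eP ∷ eval-μ rejectionᶜ r (i ∷ []) (proj₁ search) (proj₂ search) ∷ []) (runs answerᶜ r (i ∷ proj₁ search ∷ []))

  answer-correct : ∀ i → i < n → LPOval (component i (tail x)) (answer i)
  answer-correct i i<n = subst (LPOval (component i (tail x))) (cong isZero (sym (hits-cong (pair-even x (G h)) stable-stage i)))
    (stable-stage-decides x stable-stage stable i i<n)
    where
    stable : ∀ T → d T ≤ d stable-stage
    stable = accepted-stable (proj₁ search) (trans (sym (rejection-pair x (G h) (proj₁ search))) (proj₁ (proj₂ search)))

proposition15 : LPO* ≤W Minus
proposition15 = code preprocessᶜ , postprocess , λ G G-realizes x _ →
  let open Correctness G G-realizes x in
  h , (λ m → runs preprocessᶜ x (m ∷ [])) , answer , answer-computed , answer-correct
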